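{- For each $t\ge 1$ and each $k\ge 1$ there exists a $t$-PDDS$[P_k]$ in $\Lambda_2$.
   Context: $\Lambda_2$ is the infinite graph with vertex set $\mathbb{Z}^2$ in which two vertices are adjacent iff their Euclidean distance is $1$; $d$ denotes graph distance. For $S$ a set of vertices, $[S]$ is the induced subgraph and $d(v,C)=\min\{d(v,w):w\in C\}$. For $t\ge1$, $S$ is a $t$-perfect distance-dominating set ($t$-PDDS) if for each vertex $v$ there is a unique component $C_v$ of $[S]$ with $d(v,C_v)\le t$, and there is in $C_v$ a unique vertex $w$ with $d(v,w)=d(v,C_v)$. A $t$-PDDS$[H]$ is a $t$-PDDS all of whose components are isomorphic to the fixed finite graph $H$. $P_k$ is the path on $k$ vertices. -}

module Defs where

open import Data.Nat using (ℕ; zero; suc; _≤_)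
open import Data.Integer using (ℤ; _-_; _*_; _+_)
import Data.Integer as ℤ
open import Data.Fin using (Fin; toℕ)
open import Data.Product using (Σ; _×_; _,_)
open import Data.Sum using (_⊎_)
open import Relation.Binary.PropositionalEquality using (_≡_)
open import Function.Definitions using (Injective)

Vertex : Set
Vertex = ℤ × ℤ

sq : ℤ → ℤ
sq a = a * a

Adj : Vertex → Vertex → Set
Adj (x₁ , y₁) (x₂ , y₂) = sq (x₁ - x₂) + sq (y₁ - y₂) ≡ ℤ.+ 1

data Walk : Vertex → Vertex → ℕ → Set where
  here : ∀ {u} → Walk u u 0
  step : ∀ {u u′ w n} → Adj u u′ → Walk u′ w n → Walk u w (suc n)

Dist : Vertex → Vertex → ℕ → Set
Dist u w n = Walk u w n × (∀ m → Walk u w m → n ≤ m)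

VSet : Set₁
VSet = Vertex → Set

data Conn (S : VSet) : Vertex → Vertex → Set where
  here : ∀ {u} → S u → Conn S u u
  step : ∀ {u u′ w} → S u → Adj u u′ → Conn S u′ w → Conn S u w

-- t-perfect distance-dominating set: for every v there is w ∈ S such that
--  * d(v,w) = n ≤ t,
--  * every vertex u of the component C of w satisfies d(v,u) ≥ n, with equality only for u = w
--    (so d(v,C) = n and w is the unique closest vertex of C),
--  * every vertex of S within distance t of v lies in C (uniqueness of the component).
IsPDDS : ℕ → VSet → Set
IsPDDS t S =
  ∀ v → Σ Vertex λ w → S w × Σ ℕ λ n →
      Dist v w n × n ≤ t
    × (∀ u → Conn S w u → ∀ m → Dist v u m → n ≤ m × (m ≡ n → u ≡ w))
    × (∀ u → S u → ∀ m → Dist v u m → m ≤ t → Conn S w u)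

ComponentIsPath : ℕ → VSet → Vertex → Set
ComponentIsPath k S s =
  Σ (Fin k → Vertex) λ f →
      Injective _≡_ _≡_ f
    × (∀ i → Conn S s (f i))
    × (∀ u → Conn S s u → Σ (Fin k) λ i → f i ≡ u)
    × (∀ i j → (Adj (f i) (f j) → (suc (toℕ i) ≡ toℕ j ⊎ suc (toℕ j) ≡ toℕ i))
             × ((suc (toℕ i) ≡ toℕ j ⊎ suc (toℕ j) ≡ toℕ i) → Adj (f i) (f j)))

IsPDDS-P : ℕ → ℕ → VSet → Set
IsPDDS-P t k S = IsPDDS t S × (∀ s → S s → ComponentIsPath k S s)

-- Let T be the set of vertices within distance t of a horizontal path on k vertices; it has
-- D = 2t² + 2kt + k elements. With c = 2k + 2t − 1, the translates of the path by the lattice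
-- {(x , y) : x ≡ c y (mod D)} are pairwise more than 2t apart, and every vertex lies within distance t
-- of one of them, so the translates of T tile Λ₂. Any family of horizontal k-segments with these two
-- properties is a t-PDDS[P_k]: the segments are the components (they are more than 1 apart), the point
-- of a segment nearest to v is obtained by clamping the horizontal offset of v to [0, k − 1], and a
-- second segment within distance t of v would lie within 2t of the first.

module Submission where

open import Defs
open import Data.Nat.Base as ℕ using (ℕ; zero; suc; z≤n; s≤s; _≤_; _<_)
import Data.Nat.Properties as ℕ
import Data.Nat.Tactic.RingSolver as ℕ-Solver
open import Data.Nat.DivMod using (_%_; _/_; m≡m%n+[m/n]*n; m%n<n; m<n*o⇒m/o<n)
open import Data.Integer.Base using (ℤ; +_; -[1+_]; ∣_∣; _⊖_; _+_; _*_; _-_; -_; 0ℤ; 1ℤ)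
import Data.Integer.Properties as ℤ
open import Data.Integer.DivMod using (_%ℕ_; _/ℕ_; n%ℕd<d; a≡a%ℕn+[a/ℕn]*n)
open import Data.Integer.Tactic.RingSolver using (solve-∀)
open import Data.Fin.Base using (Fin; toℕ; fromℕ<)
open import Data.Fin.Properties using (toℕ-injective; toℕ<n; toℕ-fromℕ<)
open import Data.Product using (Σ; _×_; _,_; proj₁; proj₂; swap)
open import Data.Sum using (_⊎_; inj₁; inj₂)
open import Relation.Binary.PropositionalEquality
open import Relation.Nullary using (Dec; yes; no; contradiction)
open import Algebra.Properties.AbelianGroup ℤ.+-0-abelianGroup using (∙-cancelˡ)
open import Algebra.Properties.CommutativeSemigroup ℕ.+-commutativeSemigroup using (interchange)

-- Graph distance in Λ₂

taxi : Vertex → Vertex → ℕ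
taxi (x₁ , y₁) (x₂ , y₂) = ∣ x₁ - x₂ ∣ ℕ.+ ∣ y₁ - y₂ ∣

sq≡+∣∣² : ∀ a → sq a ≡ + (∣ a ∣ ℕ.* ∣ a ∣)
sq≡+∣∣² (+ zero)  = refl
sq≡+∣∣² (+ suc n) = refl
sq≡+∣∣² -[1+ n ]  = refl

squares≡1⇒sum≡1 : ∀ m n → m ℕ.* m ℕ.+ n ℕ.* n ≡ 1 → m ℕ.+ n ≡ 1
squares≡1⇒sum≡1 0             1             _  = refl
squares≡1⇒sum≡1 1             0             _  = refl
squares≡1⇒sum≡1 0             0             ()
squares≡1⇒sum≡1 0             (suc (suc n)) ()
squares≡1⇒sum≡1 1             (suc n)       ()
squares≡1⇒sum≡1 (suc (suc m)) n             ()

Adj⇒taxi≡1 : ∀ {u w} → Adj u w → taxi u w ≡ 1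
Adj⇒taxi≡1 {x₁ , y₁} {x₂ , y₂} adj = squares≡1⇒sum≡1 ∣ x₁ - x₂ ∣ ∣ y₁ - y₂ ∣ (ℤ.+-injective (begin
  + (∣ x₁ - x₂ ∣ ℕ.* ∣ x₁ - x₂ ∣ ℕ.+ ∣ y₁ - y₂ ∣ ℕ.* ∣ y₁ - y₂ ∣)
    ≡⟨ cong₂ _+_ (sq≡+∣∣² (x₁ - x₂)) (sq≡+∣∣² (y₁ - y₂)) ⟨
  sq (x₁ - x₂) + sq (y₁ - y₂)
    ≡⟨ adj ⟩
  + 1
    ∎))
  where open ≡-Reasoning

∣-∣-triangle : ∀ a b c → ∣ a - c ∣ ≤ ∣ a - b ∣ ℕ.+ ∣ b - c ∣
∣-∣-triangle a b c =
  subst (λ z → ∣ z ∣ ≤ ∣ a - b ∣ ℕ.+ ∣ b - c ∣) (telescope a b c) (ℤ.∣i+j∣≤∣i∣+∣j∣ (a - b) (b - c))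
  where
  telescope : ∀ a b c → (a - b) + (b - c) ≡ a - c
  telescope = solve-∀

∣-∣-sym : ∀ a b → ∣ a - b ∣ ≡ ∣ b - a ∣
∣-∣-sym a b = trans (cong ∣_∣ (negate a b)) (ℤ.∣-i∣≡∣i∣ (b - a))
  where
  negate : ∀ a b → a - b ≡ - (b - a)
  negate = solve-∀

taxi-triangle : ∀ u v w → taxi u w ≤ taxi u v ℕ.+ taxi v w
taxi-triangle (a₁ , a₂) (b₁ , b₂) (c₁ , c₂) = ℕ.≤-trans
  (ℕ.+-mono-≤ (∣-∣-triangle a₁ b₁ c₁) (∣-∣-triangle a₂ b₂ c₂))
  (ℕ.≤-reflexive (interchange (∣ a₁ - b₁ ∣) (∣ b₁ - c₁ ∣) (∣ a₂ - b₂ ∣) (∣ b₂ - c₂ ∣)))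

taxi-sym : ∀ u w → taxi u w ≡ taxi w u
taxi-sym (a₁ , a₂) (b₁ , b₂) = cong₂ ℕ._+_ (∣-∣-sym a₁ b₁) (∣-∣-sym a₂ b₂)

taxi-self : ∀ u → taxi u u ≡ 0
taxi-self (a₁ , a₂) rewrite ℤ.+-inverseʳ a₁ | ℤ.+-inverseʳ a₂ = refl

Walk⇒taxi≤ : ∀ {u w n} → Walk u w n → taxi u w ≤ n
Walk⇒taxi≤ {u} here = ℕ.≤-reflexive (taxi-self u)
Walk⇒taxi≤ {u} {w} {suc n} (step {u′ = v} adj p) = ℕ.≤-trans (taxi-triangle u v w)
  (subst (λ d → d ℕ.+ taxi v w ≤ suc n) (sym (Adj⇒taxi≡1 {u} {v} adj)) (s≤s (Walk⇒taxi≤ p)))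

adj-sym : ∀ {u w} → Adj u w → Adj w u
adj-sym {x₁ , y₁} {x₂ , y₂} = subst (_≡ + 1) (cong₂ _+_ (sq-negate x₁ x₂) (sq-negate y₁ y₂))
  where
  sq-negate : ∀ a b → (a - b) * (a - b) ≡ (b - a) * (b - a)
  sq-negate = solve-∀

adj-swap : ∀ {u w} → Adj u w → Adj (swap u) (swap w)
adj-swap {x₁ , y₁} {x₂ , y₂} = trans (ℤ.+-comm (sq (y₁ - y₂)) (sq (x₁ - x₂)))

adj-right : ∀ x y → Adj (x , y) (x + 1ℤ , y)
adj-right = unit-step
  where
  unit-step : ∀ x y → (x - (x + 1ℤ)) * (x - (x + 1ℤ)) + (y - y) * (y - y) ≡ 1ℤ
  unit-step = solve-∀

walk-++ : ∀ {u v w m n} → Walk u v m → Walk v w n → Walk u w (m ℕ.+ n)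
walk-++ here        q = q
walk-++ (step a p) q = step a (walk-++ p q)

walk-snoc : ∀ {u v w n} → Walk u v n → Adj v w → Walk u w (suc n)
walk-snoc here       b = step b here
walk-snoc (step a p) b = step a (walk-snoc p b)

walk-reverse : ∀ {u w n} → Walk u w n → Walk w u n
walk-reverse here       = here
walk-reverse (step {u} {v} a p) = walk-snoc (walk-reverse p) (adj-sym {u} {v} a)

walk-swap : ∀ {u w n} → Walk u w n → Walk (swap u) (swap w) n
walk-swap here       = here
walk-swap (step {u} {v} a p) = step (adj-swap {u} {v} a) (walk-swap p)

walk-rightwards : ∀ x y n → Walk (x , y) (x + + n , y) n
walk-rightwards x y zero    = subst (λ z → Walk (x , y) (z , y) 0) (sym (ℤ.+-identityʳ x)) here
walk-rightwards x y (suc n) = step (adj-right x y)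
  (subst (λ z → Walk (x + 1ℤ , y) (z , y) n) (ℤ.+-assoc x 1ℤ (+ n)) (walk-rightwards (x + 1ℤ) y n))

∣-∣-cases : ∀ a b → b ≡ a + + ∣ a - b ∣ ⊎ a ≡ b + + ∣ a - b ∣
∣-∣-cases a b with a - b in eq
... | + n      = inj₂ (trans (split a b) (cong (λ d → b + d) eq))
  where
  split : ∀ a b → a ≡ b + (a - b)
  split = solve-∀
... | -[1+ n ] = inj₁ (trans (split a b) (cong (λ d → a + - d) eq))
  where
  split : ∀ a b → b ≡ a + - (a - b)
  split = solve-∀

horizontal : ∀ x₁ x₂ y → Walk (x₁ , y) (x₂ , y) ∣ x₁ - x₂ ∣
horizontal x₁ x₂ y with ∣-∣-cases x₁ x₂
... | inj₁ eq = subst (λ x → Walk (x₁ , y) (x , y) ∣ x₁ - x₂ ∣) (sym eq)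
                  (walk-rightwards x₁ y ∣ x₁ - x₂ ∣)
... | inj₂ eq = subst (λ x → Walk (x , y) (x₂ , y) ∣ x₁ - x₂ ∣) (sym eq)
                  (walk-reverse (walk-rightwards x₂ y ∣ x₁ - x₂ ∣))

geodesic : ∀ u w → Walk u w (taxi u w)
geodesic (x₁ , y₁) (x₂ , y₂) = walk-++ (horizontal x₁ x₂ y₁) (walk-swap (horizontal y₁ y₂ x₂))

taxi-Dist : ∀ u w → Dist u w (taxi u w)
taxi-Dist u w = geodesic u w , λ _ → Walk⇒taxi≤

Dist⇒≡taxi : ∀ {u w n} → Dist u w n → n ≡ taxi u w
Dist⇒≡taxi {u} {w} (p , minimal) = ℕ.≤-antisym (minimal _ (geodesic u w)) (Walk⇒taxi≤ p)

Conn⇒source : ∀ {S u w} → Conn S u w → S u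
Conn⇒source (here s)     = s
Conn⇒source (step s _ _) = s

Conn-snoc : ∀ {S u v w} → Conn S u v → Adj v w → S w → Conn S u w
Conn-snoc (here s)       adj t = step s adj (here t)
Conn-snoc (step s a c)   adj t = step s a (Conn-snoc c adj t)

∣+m-+n∣≡m∸n : ∀ {m n} → n ≤ m → ∣ + m - + n ∣ ≡ m ℕ.∸ n
∣+m-+n∣≡m∸n {m} {n} n≤m = cong ∣_∣ (trans (ℤ.[+m]-[+n]≡m⊖n m n) (ℤ.⊖-≥ n≤m))

-- Nearest points of horizontal segments

module Clamp (κ : ℕ) where

  clamp : ℤ → ℕ
  clamp (+ n)    = n ℕ.⊓ κ
  clamp -[1+ n ] = 0

  clamp< : ∀ ρ → clamp ρ < suc κ
  clamp< (+ n)    = s≤s (ℕ.m⊓n≤n n κ)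
  clamp< -[1+ n ] = s≤s z≤n

  clamp-nonpos : ∀ n → clamp (- + n) ≡ 0
  clamp-nonpos zero    = refl
  clamp-nonpos (suc n) = refl

  clamp-nearest : ∀ ρ i → i < suc κ →
                  ∣ ρ - + clamp ρ ∣ ≤ ∣ ρ - + i ∣ × (∣ ρ - + clamp ρ ∣ ≡ ∣ ρ - + i ∣ → i ≡ clamp ρ)
  clamp-nearest (+ n) i (s≤s i≤κ) with ℕ.≤-total n κ
  ... | inj₁ n≤κ rewrite ℕ.m≤n⇒m⊓n≡m n≤κ | ℤ.+-inverseʳ (+ n) =
    z≤n , λ eq → sym (ℤ.+-injective (ℤ.i-j≡0⇒i≡j (+ n) (+ i) (ℤ.∣i∣≡0⇒i≡0 (sym eq))))
  ... | inj₂ κ≤n rewrite ℕ.m≥n⇒m⊓n≡n κ≤n | ∣+m-+n∣≡m∸n κ≤n | ∣+m-+n∣≡m∸n (ℕ.≤-trans i≤κ κ≤n) =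
    ℕ.∸-monoʳ-≤ n i≤κ , λ eq → sym (ℕ.∸-cancelˡ-≡ κ≤n (ℕ.≤-trans i≤κ κ≤n) eq)
  clamp-nearest -[1+ n ] zero    _ = ℕ.≤-refl , λ _ → refl
  clamp-nearest -[1+ n ] (suc i) _ =
    ℕ.m≤n⇒m≤1+n (s≤s (ℕ.m≤m+n n i)) , λ eq → contradiction (cong ℕ.pred eq) (ℕ.m≢1+m+n n)

  clamp-excess : ∀ e m → e < suc κ ℕ.+ m → ∣ + e - + clamp (+ e) ∣ ≤ m
  clamp-excess e m (s≤s e≤κ+m) with ℕ.≤-total e κ
  ... | inj₁ e≤κ rewrite ℕ.m≤n⇒m⊓n≡m e≤κ | ℤ.+-inverseʳ (+ e) = z≤n
  ... | inj₂ κ≤e rewrite ℕ.m≥n⇒m⊓n≡n κ≤e | ∣+m-+n∣≡m∸n κ≤e = ℕ.m≤n+o⇒m∸n≤o e κ e≤κ+m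

  clamp-within : ∀ a m → a < suc κ ℕ.+ m ℕ.+ m → ∣ (+ a - + m) - + clamp (+ a - + m) ∣ ≤ m
  clamp-within a m a< with ℕ.≤-total m a
  ... | inj₂ a≤m rewrite trans (ℤ.[+m]-[+n]≡m⊖n a m) (ℤ.⊖-≤ a≤m) | clamp-nonpos (m ℕ.∸ a)
                       | ℤ.+-identityʳ (- + (m ℕ.∸ a)) | ℤ.∣-i∣≡∣i∣ (+ (m ℕ.∸ a)) = ℕ.m∸n≤m m a
  ... | inj₁ m≤a with ℕ.m≤n⇒∃[o]m+o≡n m≤a
  ... | e , refl
    rewrite trans (ℤ.[+m]-[+n]≡m⊖n (m ℕ.+ e) m) (trans (ℤ.⊖-≥ (ℕ.m≤m+n m e)) (cong +_ (ℕ.m+n∸m≡n m e))) =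
    clamp-excess e m (ℕ.+-cancelˡ-< m e (suc κ ℕ.+ m) (subst (m ℕ.+ e <_) (ℕ.+-comm (suc κ ℕ.+ m) m) a<))

-- Unions of far-apart horizontal segments

∣m⊖n∣≡1⇒adjacent : ∀ m n → ∣ m ⊖ n ∣ ≡ 1 → suc m ≡ n ⊎ suc n ≡ m
∣m⊖n∣≡1⇒adjacent zero          (suc zero)    _  = inj₁ refl
∣m⊖n∣≡1⇒adjacent (suc zero)    zero          _  = inj₂ refl
∣m⊖n∣≡1⇒adjacent zero          zero          ()
∣m⊖n∣≡1⇒adjacent zero          (suc (suc n)) ()
∣m⊖n∣≡1⇒adjacent (suc (suc m)) zero          ()
∣m⊖n∣≡1⇒adjacent (suc m)       (suc n)       eq
  with ∣m⊖n∣≡1⇒adjacent m n (trans (cong ∣_∣ (sym (ℤ.[1+m]⊖[1+n]≡m⊖n m n))) eq)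
... | inj₁ eq′ = inj₁ (cong suc eq′)
... | inj₂ eq′ = inj₂ (cong suc eq′)

module SegmentTiling {A : Set} (anchor : A → Vertex) (κ τ : ℕ) where

  open Clamp κ

  point : A → ℕ → Vertex
  point p i = (proj₁ (anchor p) + + i , proj₂ (anchor p))

  OnSegment : A → VSet
  OnSegment p v = Σ ℕ λ i → i < suc κ × v ≡ point p i

  Tiling : VSet
  Tiling v = Σ A λ p → OnSegment p v

  Separated : Set
  Separated = ∀ {p p′ i i′} → i < suc κ → i′ < suc κ →
              taxi (point p i) (point p′ i′) ≤ suc τ ℕ.+ suc τ → p ≡ p′

  Covering : Set
  Covering = ∀ v → Σ A λ p → Σ ℕ λ i → i < suc κ × taxi v (point p i) ≤ suc τ

  offset : Vertex → A → ℤ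
  offset (x , _) p = x - proj₁ (anchor p)

  taxi-point : ∀ v p i → taxi v (point p i) ≡ ∣ offset v p - + i ∣ ℕ.+ ∣ proj₂ v - proj₂ (anchor p) ∣
  taxi-point (x , y) p i =
    cong (λ d → ∣ d ∣ ℕ.+ ∣ y - proj₂ (anchor p) ∣) (regroup x (proj₁ (anchor p)) (+ i))
    where
    regroup : ∀ x a i → x - (a + i) ≡ (x - a) - i
    regroup = solve-∀

  taxi-along : ∀ p i j → taxi (point p i) (point p j) ≡ ∣ i ⊖ j ∣
  taxi-along p i j
    rewrite ℤ.+-inverseʳ (proj₂ (anchor p)) | ℕ.+-identityʳ ∣ point p i .proj₁ - point p j .proj₁ ∣ =
    cong ∣_∣ (trans (cancel (proj₁ (anchor p)) (+ i) (+ j)) (ℤ.[+m]-[+n]≡m⊖n i j))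
    where
    cancel : ∀ a i j → (a + i) - (a + j) ≡ i - j
    cancel = solve-∀

  point-injective : ∀ p {i j} → point p i ≡ point p j → i ≡ j
  point-injective p eq = ℤ.+-injective (∙-cancelˡ (proj₁ (anchor p)) _ _ (cong proj₁ eq))

  point-adj : ∀ p i → Adj (point p i) (point p (suc i))
  point-adj p i = unit-step (proj₁ (anchor p)) (+ i) (proj₂ (anchor p))
    where
    unit-step : ∀ a i y → ((a + i) - (a + (1ℤ + i))) * ((a + i) - (a + (1ℤ + i))) + (y - y) * (y - y) ≡ 1ℤ
    unit-step = solve-∀

  point-adj-iff : ∀ p i j → (Adj (point p i) (point p j) → suc i ≡ j ⊎ suc j ≡ i)
                          × (suc i ≡ j ⊎ suc j ≡ i → Adj (point p i) (point p j))
  point-adj-iff p i j =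
      (λ adj → ∣m⊖n∣≡1⇒adjacent i j (trans (sym (taxi-along p i j)) (Adj⇒taxi≡1 {point p i} adj)))
    , λ { (inj₁ refl) → point-adj p i ; (inj₂ refl) → adj-sym {point p j} (point-adj p j) }

  on-tiling : ∀ p {i} → i < suc κ → Tiling (point p i)
  on-tiling p {i} i< = p , i , i< , refl

  Conn-rightwards : ∀ p n i → n ℕ.+ i < suc κ → Conn Tiling (point p i) (point p (n ℕ.+ i))
  Conn-rightwards p zero    i i< = here (on-tiling p i<)
  Conn-rightwards p (suc n) i i< =
    Conn-snoc (Conn-rightwards p n i (ℕ.<-trans (ℕ.n<1+n _) i<)) (point-adj p (n ℕ.+ i)) (on-tiling p i<)

  Conn-leftwards : ∀ p n i → n ℕ.+ i < suc κ → Conn Tiling (point p (n ℕ.+ i)) (point p i)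
  Conn-leftwards p zero    i i< = here (on-tiling p i<)
  Conn-leftwards p (suc n) i i< = step (on-tiling p i<) (adj-sym {point p (n ℕ.+ i)} (point-adj p (n ℕ.+ i)))
                                  (Conn-leftwards p n i (ℕ.<-trans (ℕ.n<1+n _) i<))

  segment-connected : ∀ p {i j} → i < suc κ → j < suc κ → Conn Tiling (point p i) (point p j)
  segment-connected p {i} {j} i< j< with ℕ.≤-total i j
  ... | inj₁ i≤j = subst (λ l → Conn Tiling (point p i) (point p l)) (ℕ.m∸n+n≡m i≤j)
                     (Conn-rightwards p (j ℕ.∸ i) i (subst (_< suc κ) (sym (ℕ.m∸n+n≡m i≤j)) j<))
  ... | inj₂ j≤i = subst (λ l → Conn Tiling (point p l) (point p j)) (ℕ.m∸n+n≡m j≤i)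
                     (Conn-leftwards p (i ℕ.∸ j) j (subst (_< suc κ) (sym (ℕ.m∸n+n≡m j≤i)) i<))

  module _ (separated : Separated) where

    adjacent-OnSegment : ∀ {p u w} → OnSegment p u → Adj u w → Tiling w → OnSegment p w
    adjacent-OnSegment {p} (i , i< , refl) adj (p′ , i′ , i′< , refl)
      with separated i< i′< (subst (_≤ suc τ ℕ.+ suc τ) (sym (Adj⇒taxi≡1 {point p i} adj)) (s≤s z≤n))
    ... | refl = i′ , i′< , refl

    Conn⇒OnSegment : ∀ {p w u} → OnSegment p w → Conn Tiling w u → OnSegment p u
    Conn⇒OnSegment on (here _)       = on
    Conn⇒OnSegment on (step _ adj c) = Conn⇒OnSegment (adjacent-OnSegment on adj (Conn⇒source c)) c

    isPDDS : Covering → IsPDDS (suc τ) Tiling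
    isPDDS covering v with covering v
    ... | p , i , i< , v-near =
      w , on-tiling p (clamp< ρ) , taxi v w , taxi-Dist v w , w-near , w-nearest , same-component
      where
      ρ : ℤ
      ρ = offset v p
      w : Vertex
      w = point p (clamp ρ)

      nearest-on-segment : ∀ j → j < suc κ →
        taxi v w ≤ taxi v (point p j) × (taxi v (point p j) ≡ taxi v w → j ≡ clamp ρ)
      nearest-on-segment j j< rewrite taxi-point v p j | taxi-point v p (clamp ρ) with clamp-nearest ρ j j<
      ... | closer , tie = ℕ.+-monoˡ-≤ _ closer , λ eq → tie (sym (ℕ.+-cancelʳ-≡ _ _ _ eq))

      w-near : taxi v w ≤ suc τ
      w-near = ℕ.≤-trans (proj₁ (nearest-on-segment i i<)) v-near

      w-nearest : ∀ u → Conn Tiling w u → ∀ m → Dist v u m → taxi v w ≤ m × (m ≡ taxi v w → u ≡ w)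
      w-nearest u c m d with Conn⇒OnSegment (clamp ρ , clamp< ρ , refl) c
      ... | j , j< , refl rewrite Dist⇒≡taxi d =
        proj₁ (nearest-on-segment j j<) , λ eq → cong (point p) (proj₂ (nearest-on-segment j j<) eq)

      same-component : ∀ u → Tiling u → ∀ m → Dist v u m → m ≤ suc τ → Conn Tiling w u
      same-component u (p′ , j , j< , refl) m d m≤t
        with separated (clamp< ρ) j< (ℕ.≤-trans (taxi-triangle w v u)
               (ℕ.+-mono-≤ (subst (_≤ suc τ) (taxi-sym v w) w-near) (subst (_≤ suc τ) (Dist⇒≡taxi d) m≤t)))
      ... | refl = segment-connected p (clamp< ρ) j<

    component-is-path : ∀ s → Tiling s → ComponentIsPath (suc κ) Tiling s
    component-is-path s (p , i , i< , refl) =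
        (λ j → point p (toℕ j))
      , (λ eq → toℕ-injective (point-injective p eq))
      , (λ j → segment-connected p i< (toℕ<n j))
      , onto
      , (λ a b → point-adj-iff p (toℕ a) (toℕ b))
      where
      onto : ∀ u → Conn Tiling (point p i) u → Σ (Fin (suc κ)) λ j → point p (toℕ j) ≡ u
      onto u c with Conn⇒OnSegment (i , i< , refl) c
      ... | j , j< , refl = fromℕ< j< , cong (point p) (toℕ-fromℕ< j<)

-- The lattice x ≡ c y (mod D)

residue-unique : ∀ d (n : ℤ) {a b} → a < d → b < d → n * + d + + a ≡ + b → n ≡ 0ℤ × a ≡ b
residue-unique d (+ zero)  a< b< eq = refl , ℤ.+-injective eq
residue-unique d (+ suc m) {a} {b} a< b< eq = contradiction d≤b (ℕ.<⇒≱ b<)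
  where
  d≤b : d ≤ b
  d≤b = subst (d ≤_) (ℤ.+-injective (trans (cong (_+ + a) (ℤ.pos-* (suc m) d)) eq))
          (ℕ.≤-trans (ℕ.m≤m+n d (m ℕ.* d)) (ℕ.m≤m+n _ a))
residue-unique d -[1+ m ] {a} {b} a< b< eq = contradiction d≤a (ℕ.<⇒≱ a<)
  where
  solve-for-a : ∀ n D A B → n * D + A ≡ B → A ≡ B + (- n) * D
  solve-for-a n D A B eq = trans (shift n D A) (cong (λ z → z + (- n) * D) eq)
    where
    shift : ∀ n D A → A ≡ (n * D + A) + (- n) * D
    shift = solve-∀
  a≡ : a ≡ b ℕ.+ suc m ℕ.* d
  a≡ = ℤ.+-injective (trans (solve-for-a -[1+ m ] (+ d) (+ a) (+ b) eq)
                             (cong (λ z → + b + z) (sym (ℤ.pos-* (suc m) d))))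
  d≤a : d ≤ a
  d≤a = subst (d ≤_) (sym a≡) (ℕ.≤-trans (ℕ.m≤m+n d (m ℕ.* d)) (ℕ.m≤n+m _ b))

≤-by-slack : ∀ {m n} d → m ℕ.+ d ≡ n → m ≤ n
≤-by-slack {m} d refl = ℕ.m≤m+n m d

sign-split : ∀ h → Σ ℕ λ a → Σ ℕ λ b → h + + a ≡ + b × a ℕ.+ b ≡ ∣ h ∣
sign-split (+ b)    = 0 , b , ℤ.+-identityʳ (+ b) , refl
sign-split -[1+ a ] = suc a , 0 , ℤ.+-inverseˡ (+ suc a) , ℕ.+-identityʳ (suc a)

module Lattice (κ τ : ℕ) where

  -- D is the number of vertices within distance t of a path on k vertices.
  k t c₀ c D : ℕ
  k = suc κ
  t = suc τ
  c₀ = κ ℕ.+ κ ℕ.+ t ℕ.+ t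
  c = suc c₀
  D = t ℕ.* suc c ℕ.+ k

  -- The ring solver does not unfold k, t, c₀, c and D, so identities between them are proved for
  -- variables κ τ, with the definitions restated in a let.
  c-large : t ℕ.+ t ℕ.+ κ < c
  c-large = ≤-by-slack κ (identity κ τ)
    where
    identity : ∀ κ τ →
      let k = suc κ; t = suc τ; c₀ = κ ℕ.+ κ ℕ.+ t ℕ.+ t; c = suc c₀; D = t ℕ.* suc c ℕ.+ k
      in suc (t ℕ.+ t ℕ.+ κ) ℕ.+ κ ≡ c
    identity = ℕ-Solver.solve-∀

  D-large : t ℕ.+ t ℕ.+ k ≤ D
  D-large = ≤-by-slack (t ℕ.* c₀) (identity κ τ)
    where
    identity : ∀ κ τ →
      let k = suc κ; t = suc τ; c₀ = κ ℕ.+ κ ℕ.+ t ℕ.+ t; c = suc c₀; D = t ℕ.* suc c ℕ.+ k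
      in t ℕ.+ t ℕ.+ k ℕ.+ t ℕ.* c₀ ≡ D
    identity = ℕ-Solver.solve-∀

  D≤[1+t][1+c] : D ≤ suc t ℕ.* suc c
  D≤[1+t][1+c] = ≤-by-slack (k ℕ.+ t ℕ.+ t) (identity κ τ)
    where
    identity : ∀ κ τ →
      let k = suc κ; t = suc τ; c₀ = κ ℕ.+ κ ℕ.+ t ℕ.+ t; c = suc c₀; D = t ℕ.* suc c ℕ.+ k
      in D ℕ.+ (k ℕ.+ t ℕ.+ t) ≡ suc t ℕ.* suc c
    identity = ℕ-Solver.solve-∀

  c*[1+t+o] : ∀ o → c ℕ.* (suc t ℕ.+ o) ≡ D ℕ.+ (k ℕ.+ τ ℕ.+ c ℕ.* o)
  c*[1+t+o] = identity κ τ
    where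
    identity : ∀ κ τ o →
      let k = suc κ; t = suc τ; c₀ = κ ℕ.+ κ ℕ.+ t ℕ.+ t; c = suc c₀; D = t ℕ.* suc c ℕ.+ k
      in c ℕ.* (suc t ℕ.+ o) ≡ D ℕ.+ (k ℕ.+ τ ℕ.+ c ℕ.* o)
    identity = ℕ-Solver.solve-∀

  small-residue< : ∀ {m a i} → m ≤ t → a ℕ.+ m ≤ t ℕ.+ t → i < k → c ℕ.* m ℕ.+ i ℕ.+ a < D
  small-residue< {m} {a} {i} m≤t a+m≤2t i<k = begin-strict
    c ℕ.* m ℕ.+ i ℕ.+ a             <⟨ ℕ.+-monoˡ-< a (ℕ.+-monoʳ-< (c ℕ.* m) i<k) ⟩
    c ℕ.* m ℕ.+ k ℕ.+ a             ≡⟨ regroup c₀ m k a ⟩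
    c₀ ℕ.* m ℕ.+ (a ℕ.+ m) ℕ.+ k    ≤⟨ ℕ.+-monoˡ-≤ k (ℕ.+-mono-≤ (ℕ.*-monoʳ-≤ c₀ m≤t) a+m≤2t) ⟩
    c₀ ℕ.* t ℕ.+ (t ℕ.+ t) ℕ.+ k    ≡⟨ identity κ τ ⟩
    D                               ∎
    where
    open ℕ.≤-Reasoning
    regroup : ∀ c₀ m k a → (m ℕ.+ c₀ ℕ.* m) ℕ.+ k ℕ.+ a ≡ c₀ ℕ.* m ℕ.+ (a ℕ.+ m) ℕ.+ k
    regroup = ℕ-Solver.solve-∀
    identity : ∀ κ τ →
      let k = suc κ; t = suc τ; c₀ = κ ℕ.+ κ ℕ.+ t ℕ.+ t; c = suc c₀; D = t ℕ.* suc c ℕ.+ k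
      in c₀ ℕ.* t ℕ.+ (t ℕ.+ t) ℕ.+ k ≡ D
    identity = ℕ-Solver.solve-∀

  large-residue< : ∀ {o a i} → a ℕ.+ o ≤ τ → i < k → k ℕ.+ τ ℕ.+ c ℕ.* o ℕ.+ i ℕ.+ a < D
  large-residue< {o} {a} {i} a+o≤τ i<k = begin-strict
    k ℕ.+ τ ℕ.+ c ℕ.* o ℕ.+ i ℕ.+ a      <⟨ ℕ.+-monoˡ-< a (ℕ.+-monoʳ-< (k ℕ.+ τ ℕ.+ c ℕ.* o) i<k) ⟩
    k ℕ.+ τ ℕ.+ c ℕ.* o ℕ.+ k ℕ.+ a      ≤⟨ ℕ.+-monoʳ-≤ (k ℕ.+ τ ℕ.+ c ℕ.* o ℕ.+ k) (ℕ.m≤n*m a c) ⟩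
    k ℕ.+ τ ℕ.+ c ℕ.* o ℕ.+ k ℕ.+ c ℕ.* a  ≡⟨ regroup k τ c o a ⟩
    k ℕ.+ τ ℕ.+ k ℕ.+ c ℕ.* (a ℕ.+ o)    ≤⟨ ℕ.+-monoʳ-≤ (k ℕ.+ τ ℕ.+ k) (ℕ.*-monoʳ-≤ c a+o≤τ) ⟩
    k ℕ.+ τ ℕ.+ k ℕ.+ c ℕ.* τ            ≤⟨ ≤-by-slack (suc (κ ℕ.+ t ℕ.+ t)) (identity κ τ) ⟩
    D                                    ∎
    where
    open ℕ.≤-Reasoning
    regroup : ∀ k τ c o a → k ℕ.+ τ ℕ.+ c ℕ.* o ℕ.+ k ℕ.+ c ℕ.* a ≡ k ℕ.+ τ ℕ.+ k ℕ.+ c ℕ.* (a ℕ.+ o)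
    regroup = ℕ-Solver.solve-∀
    identity : ∀ κ τ →
      let k = suc κ; t = suc τ; c₀ = κ ℕ.+ κ ℕ.+ t ℕ.+ t; c = suc c₀; D = t ℕ.* suc c ℕ.+ k
      in k ℕ.+ τ ℕ.+ k ℕ.+ c ℕ.* τ ℕ.+ suc (κ ℕ.+ t ℕ.+ t) ≡ D
    identity = ℕ-Solver.solve-∀

  b+i<D : ∀ {b i} → b ≤ t ℕ.+ t → i < k → b ℕ.+ i < D
  b+i<D b≤2t i<k = ℕ.<-≤-trans (ℕ.+-mono-≤-< b≤2t i<k) D-large

  -- Segment points (c y₁ + q₁ D + i₁ , y₁) and (c y₂ + q₂ D + i₂ , y₂) with y₁ − y₂ = m, q₁ − q₂ = n
  -- and x₁ − x₂ = b − a satisfy the residue equation below. For m ≤ t both residues lie in [0 , D);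
  -- for m > t they do after one period D is moved from the residue c m into the multiple of D.
  lattice-gap-near : ∀ n {m a b i₁ i₂} → m ≤ t → i₁ < k → i₂ < k → a ℕ.+ b ℕ.+ m ≤ t ℕ.+ t →
                     n * + D + + (c ℕ.* m ℕ.+ i₁ ℕ.+ a) ≡ + (b ℕ.+ i₂) → m ≡ 0 × n ≡ 0ℤ
  lattice-gap-near n {m} {a} {b} {i₁} {i₂} m≤t i₁<k i₂<k bound eq = m≡0 m (proj₂ unique) , proj₁ unique
    where
    b≤2t : b ≤ t ℕ.+ t
    b≤2t = ℕ.≤-trans (ℕ.≤-trans (ℕ.m≤n+m b a) (ℕ.m≤m+n (a ℕ.+ b) m)) bound
    unique : n ≡ 0ℤ × c ℕ.* m ℕ.+ i₁ ℕ.+ a ≡ b ℕ.+ i₂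
    unique = residue-unique D n (small-residue< m≤t (ℕ.≤-trans (ℕ.+-monoˡ-≤ m (ℕ.m≤m+n a b)) bound) i₁<k)
                                (b+i<D b≤2t i₂<k) eq
    m≡0 : ∀ m → c ℕ.* m ℕ.+ i₁ ℕ.+ a ≡ b ℕ.+ i₂ → m ≡ 0
    m≡0 zero    _  = refl
    m≡0 (suc m) eq = contradiction c≤2t+κ (ℕ.<⇒≱ c-large)
      where
      open ℕ.≤-Reasoning
      c≤2t+κ : c ≤ t ℕ.+ t ℕ.+ κ
      c≤2t+κ = begin
        c                              ≤⟨ ℕ.m≤m*n c (suc m) ⟩
        c ℕ.* suc m                    ≤⟨ ℕ.≤-trans (ℕ.m≤m+n _ i₁) (ℕ.m≤m+n _ a) ⟩
        c ℕ.* suc m ℕ.+ i₁ ℕ.+ a        ≡⟨ eq ⟩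
        b ℕ.+ i₂                        ≤⟨ ℕ.+-mono-≤ b≤2t (ℕ.≤-pred i₂<k) ⟩
        t ℕ.+ t ℕ.+ κ                  ∎

  lattice-gap-far : ∀ n o {a b i₁ i₂} → i₁ < k → i₂ < k → a ℕ.+ b ℕ.+ (suc t ℕ.+ o) ≤ t ℕ.+ t →
                    n * + D + + (c ℕ.* (suc t ℕ.+ o) ℕ.+ i₁ ℕ.+ a) ≢ + (b ℕ.+ i₂)
  lattice-gap-far n o {a} {b} {i₁} {i₂} i₁<k i₂<k bound eq = ℕ.<⇒≢ b+i₂<residue (sym (proj₂ unique))
    where
    residue : ℕ
    residue = k ℕ.+ τ ℕ.+ c ℕ.* o ℕ.+ i₁ ℕ.+ a

    a+b+o≤τ : a ℕ.+ b ℕ.+ o ≤ τ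
    a+b+o≤τ = ℕ.≤-pred (ℕ.+-cancelˡ-≤ t _ _ (subst (_≤ t ℕ.+ t) (regroup t a b o) bound))
      where
      regroup : ∀ t a b o → a ℕ.+ b ℕ.+ (suc t ℕ.+ o) ≡ t ℕ.+ suc (a ℕ.+ b ℕ.+ o)
      regroup = ℕ-Solver.solve-∀

    b≤τ : b ≤ τ
    b≤τ = ℕ.≤-trans (ℕ.≤-trans (ℕ.m≤n+m b a) (ℕ.m≤m+n (a ℕ.+ b) o)) a+b+o≤τ

    a+o≤τ : a ℕ.+ o ≤ τ
    a+o≤τ = ℕ.≤-trans (ℕ.+-monoˡ-≤ o (ℕ.m≤m+n a b)) a+b+o≤τ

    shifted : (n + 1ℤ) * + D + + residue ≡ + (b ℕ.+ i₂)
    shifted = begin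
      (n + 1ℤ) * + D + + residue                      ≡⟨ shift n (+ D) (+ residue) ⟩
      n * + D + (+ D + + residue)                     ≡⟨ cong (λ z → n * + D + + z) (sym split) ⟩
      n * + D + + (c ℕ.* (suc t ℕ.+ o) ℕ.+ i₁ ℕ.+ a)  ≡⟨ eq ⟩
      + (b ℕ.+ i₂)                                    ∎
      where
      open ≡-Reasoning
      shift : ∀ n D z → (n + 1ℤ) * D + z ≡ n * D + (D + z)
      shift = solve-∀
      reassociate : ∀ D w i a → D ℕ.+ w ℕ.+ i ℕ.+ a ≡ D ℕ.+ (w ℕ.+ i ℕ.+ a)
      reassociate = ℕ-Solver.solve-∀
      split : c ℕ.* (suc t ℕ.+ o) ℕ.+ i₁ ℕ.+ a ≡ D ℕ.+ residue
      split = trans (cong (λ z → z ℕ.+ i₁ ℕ.+ a) (c*[1+t+o] o)) (reassociate D (k ℕ.+ τ ℕ.+ c ℕ.* o) i₁ a)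

    unique : n + 1ℤ ≡ 0ℤ × residue ≡ b ℕ.+ i₂
    unique = residue-unique D (n + 1ℤ) (large-residue< a+o≤τ i₁<k)
               (b+i<D (ℕ.≤-trans b≤τ (ℕ.≤-trans (ℕ.n≤1+n τ) (ℕ.m≤m+n t t))) i₂<k) shifted

    b+i₂<residue : b ℕ.+ i₂ < residue
    b+i₂<residue = ℕ.<-≤-trans (subst (b ℕ.+ i₂ <_) (ℕ.+-comm τ k) (ℕ.+-mono-≤-< b≤τ i₂<k))
                     (ℕ.≤-trans (ℕ.m≤m+n (k ℕ.+ τ) (c ℕ.* o)) (ℕ.≤-trans (ℕ.m≤m+n _ i₁) (ℕ.m≤m+n _ a)))

  lattice-gap : ∀ n m a b {i₁ i₂} → i₁ < k → i₂ < k → a ℕ.+ b ℕ.+ m ≤ t ℕ.+ t →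
                n * + D + + (c ℕ.* m ℕ.+ i₁ ℕ.+ a) ≡ + (b ℕ.+ i₂) → m ≡ 0 × n ≡ 0ℤ
  lattice-gap n m a b i₁<k i₂<k bound eq with m ℕ.≤? t
  ... | yes m≤t = lattice-gap-near n m≤t i₁<k i₂<k bound eq
  ... | no m≰t with ℕ.m≤n⇒∃[o]m+o≡n (ℕ.≰⇒> m≰t)
  ...   | o , refl = contradiction eq (lattice-gap-far n o i₁<k i₂<k bound)

  anchor : ℤ × ℤ → Vertex
  anchor (q , y) = (+ c * y + q * + D , y)

  open SegmentTiling anchor κ τ public
  open Clamp κ

  separated-upward : ∀ {q₁ y₁ q₂ y₂ i₁ i₂} m → i₁ < k → i₂ < k → y₁ - y₂ ≡ + m →
    taxi (point (q₁ , y₁) i₁) (point (q₂ , y₂) i₂) ≤ t ℕ.+ t → m ≡ 0 × q₁ - q₂ ≡ 0ℤ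
  separated-upward {q₁} {y₁} {q₂} {y₂} {i₁} {i₂} m i₁<k i₂<k Δy near
    with sign-split (proj₁ (point (q₁ , y₁) i₁) - proj₁ (point (q₂ , y₂) i₂))
  ... | a , b , h+a≡b , a+b≡∣h∣ = lattice-gap (q₁ - q₂) m a b i₁<k i₂<k bound residues
    where
    bound : a ℕ.+ b ℕ.+ m ≤ t ℕ.+ t
    bound = subst (λ z → z ℕ.+ m ≤ t ℕ.+ t) (sym a+b≡∣h∣)
              (subst (λ z → ∣ proj₁ (point (q₁ , y₁) i₁) - proj₁ (point (q₂ , y₂) i₂) ∣ ℕ.+ ∣ z ∣ ≤ t ℕ.+ t)
                     Δy near)
    regroup : ∀ C D q₁ q₂ y₁ y₂ i₁ i₂ a →
              (q₁ - q₂) * D + (C * (y₁ - y₂) + i₁ + a)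
                ≡ ((C * y₁ + q₁ * D + i₁) - (C * y₂ + q₂ * D + i₂)) + a + i₂
    regroup = solve-∀
    residues : (q₁ - q₂) * + D + + (c ℕ.* m ℕ.+ i₁ ℕ.+ a) ≡ + (b ℕ.+ i₂)
    residues = begin
      (q₁ - q₂) * + D + + (c ℕ.* m ℕ.+ i₁ ℕ.+ a)
        ≡⟨ cong (λ z → (q₁ - q₂) * + D + (z + + i₁ + + a))
                (trans (ℤ.pos-* c m) (cong (λ z → + c * z) (sym Δy))) ⟩
      (q₁ - q₂) * + D + (+ c * (y₁ - y₂) + + i₁ + + a)
        ≡⟨ regroup (+ c) (+ D) q₁ q₂ y₁ y₂ (+ i₁) (+ i₂) (+ a) ⟩
      (proj₁ (point (q₁ , y₁) i₁) - proj₁ (point (q₂ , y₂) i₂)) + + a + + i₂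
        ≡⟨ cong (_+ + i₂) h+a≡b ⟩
      + (b ℕ.+ i₂)
        ∎
      where open ≡-Reasoning

  separated : Separated
  separated {q₁ , y₁} {q₂ , y₂} {i₁} {i₂} i₁<k i₂<k near = by-height (y₁ - y₂) refl
    where
    negate : ∀ a b → a - b ≡ - (b - a)
    negate = solve-∀
    by-height : ∀ Δ → y₁ - y₂ ≡ Δ → (q₁ , y₁) ≡ (q₂ , y₂)
    by-height (+ m) Δy with separated-upward {q₁} {y₁} {q₂} {y₂} m i₁<k i₂<k Δy near
    ... | refl , Δq≡0 = cong₂ _,_ (ℤ.i-j≡0⇒i≡j q₁ q₂ Δq≡0) (ℤ.i-j≡0⇒i≡j y₁ y₂ Δy)
    by-height -[1+ m ] Δy
      with separated-upward {q₂} {y₂} {q₁} {y₁} (suc m) i₂<k i₁<k (trans (negate y₂ y₁) (cong -_ Δy))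
             (subst (_≤ t ℕ.+ t) (taxi-sym (point (q₁ , y₁) i₁) (point (q₂ , y₂) i₂)) near)
    ... | () , _

  -- Write x − c y + t = Q D + n (c + 1) + s and m = t − n. If s < k + 2m, then v = (x , y) is within
  -- distance t of the segment n rows above v in the same period Q; otherwise it is within distance t
  -- of the segment m rows below v in the next period.
  residue-decomposition : ∀ x y → Σ ℤ λ Q → Σ ℕ λ n → Σ ℕ λ m → Σ ℕ λ s →
    n ℕ.+ m ≡ t × s < suc c × x ≡ + c * y + Q * + D + (+ s + + n * + suc c) - (+ n + + m)
  residue-decomposition x y = Q , n , t ℕ.∸ n , s , n+m≡t , m%n<n r (suc c) , x≡
    where
    z : ℤ
    z = x - + c * y + + t
    r n s : ℕ
    r = z %ℕ D
    n = r / suc c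
    s = r % suc c
    Q : ℤ
    Q = z /ℕ D

    n+m≡t : n ℕ.+ (t ℕ.∸ n) ≡ t
    n+m≡t = ℕ.m+[n∸m]≡n (ℕ.≤-pred (m<n*o⇒m/o<n (ℕ.<-≤-trans (n%ℕd<d z D) D≤[1+t][1+c])))

    isolate : ∀ x a t → x ≡ (x - a + t) + a - t
    isolate = solve-∀
    regroup : ∀ R C y Q D T → R + Q * D + C * y - T ≡ C * y + Q * D + R - T
    regroup = solve-∀
    r≡ : + r ≡ + s + + n * + suc c
    r≡ = trans (cong +_ (m≡m%n+[m/n]*n r (suc c))) (cong (λ w → + s + w) (ℤ.pos-* n (suc c)))

    x≡ : x ≡ + c * y + Q * + D + (+ s + + n * + suc c) - (+ n + + (t ℕ.∸ n))
    x≡ = begin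
      x                                  ≡⟨ isolate x (+ c * y) (+ t) ⟩
      z + + c * y - + t                  ≡⟨ cong (λ w → w + + c * y - + t) (a≡a%ℕn+[a/ℕn]*n z D) ⟩
      + r + Q * + D + + c * y - + t      ≡⟨ cong₂ (λ u v → u + Q * + D + + c * y - v) r≡ (cong +_ (sym n+m≡t)) ⟩
      (+ s + + n * + suc c) + Q * + D + + c * y - (+ n + + (t ℕ.∸ n))
        ≡⟨ regroup (+ s + + n * + suc c) (+ c) y Q (+ D) (+ n + + (t ℕ.∸ n)) ⟩
      + c * y + Q * + D + (+ s + + n * + suc c) - (+ n + + (t ℕ.∸ n))  ∎
      where open ≡-Reasoning

  ∣y-[y+n]∣≡n : ∀ y n → ∣ y - (y + + n) ∣ ≡ n
  ∣y-[y+n]∣≡n y n = trans (cong ∣_∣ (cancel y (+ n))) (ℤ.∣-i∣≡∣i∣ (+ n))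
    where
    cancel : ∀ y d → y - (y + d) ≡ - d
    cancel = solve-∀

  ∣y-[y-n]∣≡n : ∀ y n → ∣ y - (y - + n) ∣ ≡ n
  ∣y-[y-n]∣≡n y n = cong ∣_∣ (cancel y (+ n))
    where
    cancel : ∀ y d → y - (y - d) ≡ d
    cancel = solve-∀

  near-segment-above : ∀ {x y Q n m s} → n ℕ.+ m ≡ t → s < k ℕ.+ m ℕ.+ m →
    x ≡ + c * y + Q * + D + (+ s + + n * + suc c) - (+ n + + m) →
    taxi (x , y) (point (Q , y + + n) (clamp (+ s - + m))) ≤ t
  near-segment-above {x} {y} {Q} {n} {m} {s} n+m≡t s< x≡ = begin
    taxi (x , y) (point (Q , y + + n) i)                           ≡⟨ taxi-point (x , y) (Q , y + + n) i ⟩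
    ∣ offset (x , y) (Q , y + + n) - + i ∣ ℕ.+ ∣ y - (y + + n) ∣
                                            ≡⟨ cong₂ (λ ρ d → ∣ ρ - + i ∣ ℕ.+ d) offset≡ (∣y-[y+n]∣≡n y n) ⟩
    ∣ (+ s - + m) - + i ∣ ℕ.+ n                                    ≤⟨ ℕ.+-monoˡ-≤ n (clamp-within s m s<) ⟩
    m ℕ.+ n                                                        ≡⟨ trans (ℕ.+-comm m n) n+m≡t ⟩
    t                                                              ∎
    where
    open ℕ.≤-Reasoning
    i : ℕ
    i = clamp (+ s - + m)
    cancel : ∀ C y Q D S N M → (C * y + Q * D + (S + N * (1ℤ + C)) - (N + M)) - (C * (y + N) + Q * D) ≡ S - M
    cancel = solve-∀
    offset≡ : offset (x , y) (Q , y + + n) ≡ + s - + m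
    offset≡ = trans (cong (λ w → w - (+ c * (y + + n) + Q * + D)) x≡)
                    (cancel (+ c) y Q (+ D) (+ s) (+ n) (+ m))

  near-segment-below : ∀ {x y Q n m e} → n ℕ.+ m ≡ t → k ℕ.+ m ℕ.+ m ℕ.+ e < suc c →
    x ≡ + c * y + Q * + D + (+ (k ℕ.+ m ℕ.+ m ℕ.+ e) + + n * + suc c) - (+ n + + m) →
    taxi (x , y) (point (Q + 1ℤ , y - + m) (clamp (+ e - + n))) ≤ t
  near-segment-below {x} {y} {Q} {n} {m} {e} n+m≡t s< x≡ = begin
    taxi (x , y) (point (Q + 1ℤ , y - + m) i)                            ≡⟨ taxi-point (x , y) (Q + 1ℤ , y - + m) i ⟩
    ∣ offset (x , y) (Q + 1ℤ , y - + m) - + i ∣ ℕ.+ ∣ y - (y - + m) ∣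
                                            ≡⟨ cong₂ (λ ρ d → ∣ ρ - + i ∣ ℕ.+ d) offset≡ (∣y-[y-n]∣≡n y m) ⟩
    ∣ (+ e - + n) - + i ∣ ℕ.+ m                                          ≤⟨ ℕ.+-monoˡ-≤ m (clamp-within e n e<) ⟩
    n ℕ.+ m                                                              ≡⟨ n+m≡t ⟩
    t                                                                    ∎
    where
    open ℕ.≤-Reasoning
    i : ℕ
    i = clamp (+ e - + n)

    period-split : suc c ≡ (k ℕ.+ m ℕ.+ m) ℕ.+ (k ℕ.+ n ℕ.+ n)
    period-split = subst (λ t → suc (suc (κ ℕ.+ κ ℕ.+ t ℕ.+ t)) ≡ (k ℕ.+ m ℕ.+ m) ℕ.+ (k ℕ.+ n ℕ.+ n))
                     n+m≡t (identity κ n m)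
      where
      identity : ∀ κ n m → let t = n ℕ.+ m in
                 suc (suc (κ ℕ.+ κ ℕ.+ t ℕ.+ t)) ≡ (suc κ ℕ.+ m ℕ.+ m) ℕ.+ (suc κ ℕ.+ n ℕ.+ n)
      identity = ℕ-Solver.solve-∀

    e< : e < k ℕ.+ n ℕ.+ n
    e< = ℕ.+-cancelˡ-< (k ℕ.+ m ℕ.+ m) e (k ℕ.+ n ℕ.+ n) (subst (k ℕ.+ m ℕ.+ m ℕ.+ e <_) period-split s<)

    D≡ : + D ≡ (+ n + + m) * (1ℤ + + c) + + k
    D≡ = cong (_+ + k) (trans (ℤ.pos-* t (suc c)) (cong (_* + suc c) (cong +_ (sym n+m≡t))))

    cancel : ∀ C y Q K N M E → let D = (N + M) * (1ℤ + C) + K in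
             (C * y + Q * D + ((K + M + M + E) + N * (1ℤ + C)) - (N + M)) - (C * (y - M) + (Q + 1ℤ) * D) ≡ E - N
    cancel = solve-∀

    offset≡ : offset (x , y) (Q + 1ℤ , y - + m) ≡ + e - + n
    offset≡ = trans (cong (λ w → w - (+ c * (y - + m) + (Q + 1ℤ) * + D)) x≡) (trans
      (cong (λ D′ → (+ c * y + Q * D′ + (+ (k ℕ.+ m ℕ.+ m ℕ.+ e) + + n * + suc c) - (+ n + + m))
                    - (+ c * (y - + m) + (Q + 1ℤ) * D′)) D≡)
      (cancel (+ c) y Q (+ k) (+ n) (+ m) (+ e)))

  covering : Covering
  covering (x , y) with residue-decomposition x y
  ... | Q , n , m , s , n+m≡t , s<1+c , x≡ with s ℕ.<? k ℕ.+ m ℕ.+ m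
  ...   | yes s< =
    (Q , y + + n) , clamp (+ s - + m) , clamp< (+ s - + m) , near-segment-above {x} {y} {Q} n+m≡t s< x≡
  ...   | no s≮ with ℕ.m≤n⇒∃[o]m+o≡n (ℕ.≮⇒≥ s≮)
  ...     | e , refl =
    (Q + 1ℤ , y - + m) , clamp (+ e - + n) , clamp< (+ e - + n) , near-segment-below {x} {y} {Q} n+m≡t s<1+c x≡

theorem8 : (t k : ℕ) → 1 ≤ t → 1 ≤ k → Σ VSet λ S → IsPDDS-P t k S
theorem8 (suc τ) (suc κ) _ _ = Tiling , isPDDS separated covering , component-is-path separated
  where open Lattice κ τ
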